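{- Let $\ell$ be a line of $\mathrm{PG}_q(\mathbb{F}_{q^t})$ with $o(\ell)=m$, and let $d,d'$ be integers with $d\equiv d'\pmod{\theta_{m-1}}$. Then $\ell^d$ is $\mathrm{PGL}(t,q)$-equivalent to $\ell^{d'}$.
   Context: $\mathrm{PG}_q(\mathbb{F}_{q^t})\cong\mathrm{PG}(t-1,q)$ has as points the sets $\langle x\rangle_q=\mathbb{F}_q x$, $x\in\mathbb{F}_{q^t}^*$. $\theta_s=(q^{s+1}-1)/(q-1)$. For a line $\ell$ with underlying two-dimensional $\mathbb{F}_q$-subspace $\hat\ell$ of $\mathbb{F}_{q^t}$, the order $o(\ell)$ is the smallest positive integer $m$ such that $\hat\ell$ is contained in a one-dimensional $\mathbb{F}_{q^m}$-subspace of $\mathbb{F}_{q^t}$ (with $\mathbb{F}_{q^m}$ a subfield of $\mathbb{F}_{q^t}$). For an integer $d$ and a point set $\mathcal{H}$, $\mathcal{H}^d=\{\langle x^d\rangle_q:\langle x\rangle_q\in\mathcal{H}\}$. -}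

module Defs where

open import Level using (Level; _⊔_) renaming (suc to lsuc)
open import Algebra.Bundles using (CommutativeRing)
open import Data.Nat using (ℕ; zero; suc; _^_; _≤_; _<_)
import Data.Nat as ℕ
open import Data.Nat.Divisibility using (_∣_)
open import Data.Integer using (ℤ; +_; -[1+_])
open import Data.Fin using (Fin)
open import Data.Product using (Σ; _×_; ∃; ∃-syntax; _,_)
open import Relation.Binary.PropositionalEquality using (_≡_)
open import Relation.Nullary using (¬_)

record Field (c ℓ : Level) : Set (lsuc (c ⊔ ℓ)) where
  field
    commutativeRing : CommutativeRing c ℓ
  open CommutativeRing commutativeRing public
  field
    _⁻¹     : Carrier → Carrier
    1≉0     : ¬ (1# ≈ 0#)
    inverseʳ : ∀ x → ¬ (x ≈ 0#) → (x * (x ⁻¹)) ≈ 1#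

module _ {c ℓ : Level} (K : Field c ℓ) where
  open Field K

  HasCard : ℕ → Set (c ⊔ ℓ)
  HasCard n = Σ (Fin n → Carrier) λ e →
    (∀ i j → e i ≈ e j → i ≡ j) × (∀ x → ∃[ i ] (e i ≈ x))

  pow : Carrier → ℕ → Carrier
  pow x zero    = 1#
  pow x (suc n) = x * pow x n

  zpow : Carrier → ℤ → Carrier
  zpow x (+ n)     = pow x n
  zpow x -[1+ n ]  = pow (x ⁻¹) (suc n)

  -- Membership in the subfield F_{q^m} = { x | x^(q^m) = x } of K
  InSub : ℕ → ℕ → Carrier → Set ℓ
  InSub q m x = pow x (q ^ m) ≈ x

  InFq : ℕ → Carrier → Set ℓ
  InFq q = InSub q 1

  NonZero : Carrier → Set ℓ
  NonZero x = ¬ (x ≈ 0#)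

  -- a, b are F_q-linearly independent; they span the 2-dim F_q-subspace ℓ̂
  IsLine : ℕ → Carrier → Carrier → Set (c ⊔ ℓ)
  IsLine q a b = ∀ λ₁ λ₂ → InFq q λ₁ → InFq q λ₂ →
    ((λ₁ * a) + (λ₂ * b)) ≈ 0# → (λ₁ ≈ 0#) × (λ₂ ≈ 0#)

  InLine : ℕ → Carrier → Carrier → Carrier → Set (c ⊔ ℓ)
  InLine q a b x = ∃[ λ₁ ] ∃[ λ₂ ] (InFq q λ₁ × InFq q λ₂ × (x ≈ ((λ₁ * a) + (λ₂ * b))))

  -- ℓ̂ is contained in the one-dimensional F_{q^m}-subspace c·F_{q^m}
  -- for some nonzero c (F_{q^m} a subfield of F_{q^t}, i.e. m ∣ t)
  ContainedIn1dim : ℕ → ℕ → ℕ → Carrier → Carrier → Set (c ⊔ ℓ)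
  ContainedIn1dim q t m a b = (m ∣ t) × ∃[ γ ] (NonZero γ ×
    (∀ x → InLine q a b x → ∃[ y ] (InSub q m y × (x ≈ (γ * y)))))

  HasOrder : ℕ → ℕ → Carrier → Carrier → ℕ → Set (c ⊔ ℓ)
  HasOrder q t a b m = (1 ≤ m) × ContainedIn1dim q t m a b ×
    (∀ m′ → 1 ≤ m′ → m′ < m → ¬ ContainedIn1dim q t m′ a b)

  SamePoint : ℕ → Carrier → Carrier → Set (c ⊔ ℓ)
  SamePoint q y z = ∃[ λ₁ ] (InFq q λ₁ × NonZero λ₁ × (y ≈ (λ₁ * z)))

  -- φ is an invertible F_q-linear map of K (an element of GL(t,q))
  IsGL : ℕ → (Carrier → Carrier) → Set (c ⊔ ℓ)
  IsGL q φ = (∀ x y → x ≈ y → φ x ≈ φ y)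
           × (∀ x y → φ (x + y) ≈ (φ x + φ y))
           × (∀ λ₁ x → InFq q λ₁ → φ (λ₁ * x) ≈ (λ₁ * φ x))
           × (∀ x y → φ x ≈ φ y → x ≈ y)
           × (∀ y → ∃[ x ] (φ x ≈ y))

  -- ℓ^d and ℓ^{d'} (ℓ spanned by a, b) are PGL(t,q)-equivalent: some
  -- φ ∈ GL(t,q) maps the point set ℓ^d onto the point set ℓ^{d'}.
  PGLEquivPowers : ℕ → Carrier → Carrier → ℤ → ℤ → Set (c ⊔ ℓ)
  PGLEquivPowers q a b d d′ = ∃[ φ ] (IsGL q φ ×
    (∀ x → InLine q a b x → NonZero x →
       ∃[ x′ ] (InLine q a b x′ × NonZero x′ × SamePoint q (φ (zpow x d)) (zpow x′ d′)))
    × (∀ x′ → InLine q a b x′ → NonZero x′ →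
       ∃[ x ] (InLine q a b x × NonZero x × SamePoint q (φ (zpow x d)) (zpow x′ d′))))

-- θ_s = (q^{s+1} - 1)/(q - 1) = 1 + q + ... + q^s
θ : ℕ → ℕ → ℕ
θ q zero    = 1
θ q (suc s) = θ q s ℕ.+ q ^ suc s

module Submission where

-- Let o(ℓ) = m = s + 1, so the underlying subspace ℓ̂ lies in
-- γ·F_{q^m} for some γ ≠ 0.  Every nonzero x ∈ ℓ̂ is then x = γ·y with
-- y ∈ F_{q^m}^*, and for the multiplication map φ(z) = γ^{d′-d}·z we get
--   φ(x^d) = γ^{d′}·y^d = y^{d-d′} · (γ·y)^{d′} = y^{d-d′} · x^{d′}.
-- Since θ_s divides d - d′ and the norm y^{θ_s} of y ∈ F_{q^{s+1}}^* lies
-- in F_q, the factor y^{d-d′} is a nonzero element of F_q, so φ maps the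
-- point ⟨x^d⟩ of ℓ^d to the point ⟨x^{d′}⟩ of ℓ^{d′}; as φ ∈ GL(t,q),
-- this gives the PGL(t,q)-equivalence.

open import Defs
open import Level using (Level)
open import Data.Nat using (ℕ; _^_; _≤_; _∸_)
open import Data.Nat.Primality using (Prime)
open import Data.Integer using (ℤ; +_; _-_)
open import Data.Integer.Divisibility using (_∣_)
open import Relation.Binary.PropositionalEquality using (_≡_)

open import Data.Nat using (zero; suc)
import Data.Nat as ℕ
import Data.Nat.Properties as ℕP
open import Data.Nat.Divisibility using (divides)
open import Data.Integer using (-[1+_]; _⊖_)
import Data.Integer as ℤ
import Data.Integer.Properties as ℤP
open import Data.Product using (_×_; ∃-syntax; _,_)
import Relation.Binary.PropositionalEquality as ≡
import Data.Nat.Tactic.RingSolver as ℕSolver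
import Data.Integer.Tactic.RingSolver as ℤSolver
import Algebra.Properties.CommutativeSemigroup as CommSemigroupProperties
import Relation.Binary.Reasoning.Setoid as SetoidReasoning

-- θ_{s+1} computed in two ways: q·θ_s + 1 = θ_s + q^{s+1}.
θ-shift : ∀ q s → 1 ℕ.+ θ q s ℕ.* q ≡ θ q s ℕ.+ q ^ suc s
θ-shift q zero    = ≡.cong suc (ℕP.*-comm 1 q)
θ-shift q (suc s) = begin
  1 ℕ.+ (θ q s ℕ.+ q ^ suc s) ℕ.* q       ≡⟨ regroup (θ q s) (q ^ suc s) q ⟩
  (1 ℕ.+ θ q s ℕ.* q) ℕ.+ q ℕ.* q ^ suc s ≡⟨ ≡.cong (ℕ._+ q ^ suc (suc s)) (θ-shift q s) ⟩
  θ q s ℕ.+ q ^ suc s ℕ.+ q ^ suc (suc s) ∎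
  where
  open ≡.≡-Reasoning
  regroup : ∀ t r q → 1 ℕ.+ (t ℕ.+ r) ℕ.* q ≡ (1 ℕ.+ t ℕ.* q) ℕ.+ q ℕ.* r
  regroup = ℕSolver.solve-∀

minus-plus : ∀ i j → (i - j) ℤ.+ j ≡ i
minus-plus = ℤSolver.solve-∀

module FieldTheory {c ℓ : Level} (K : Field c ℓ) where
  open Field K hiding (zero; _-_)
  open CommSemigroupProperties *-commutativeSemigroup
    using (interchange; x∙yz≈y∙xz; xy∙z≈xz∙y)
  open SetoidReasoning setoid

  infixr 8 _^ⁿ_ _^ᶻ_
  _^ⁿ_ : Carrier → ℕ → Carrier
  x ^ⁿ n = pow K x n

  _^ᶻ_ : Carrier → ℤ → Carrier
  x ^ᶻ i = zpow K x i

  ^ⁿ-cong : ∀ {x y} n → x ≈ y → x ^ⁿ n ≈ y ^ⁿ n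
  ^ⁿ-cong zero    x≈y = refl
  ^ⁿ-cong (suc n) x≈y = *-cong x≈y (^ⁿ-cong n x≈y)

  ^ⁿ-≡ : ∀ x {m n} → m ≡ n → x ^ⁿ m ≈ x ^ⁿ n
  ^ⁿ-≡ x m≡n = reflexive (≡.cong (x ^ⁿ_) m≡n)

  ^ⁿ-+ : ∀ x m n → x ^ⁿ (m ℕ.+ n) ≈ x ^ⁿ m * x ^ⁿ n
  ^ⁿ-+ x zero    n = sym (*-identityˡ _)
  ^ⁿ-+ x (suc m) n = trans (*-cong refl (^ⁿ-+ x m n)) (sym (*-assoc _ _ _))

  *-^ⁿ : ∀ x y n → (x * y) ^ⁿ n ≈ x ^ⁿ n * y ^ⁿ n
  *-^ⁿ x y zero    = sym (*-identityˡ _)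
  *-^ⁿ x y (suc n) = trans (*-cong refl (*-^ⁿ x y n)) (interchange x y _ _)

  1-^ⁿ : ∀ n → 1# ^ⁿ n ≈ 1#
  1-^ⁿ zero    = refl
  1-^ⁿ (suc n) = trans (*-identityˡ _) (1-^ⁿ n)

  ^ⁿ-^ⁿ : ∀ x m n → (x ^ⁿ m) ^ⁿ n ≈ x ^ⁿ (m ℕ.* n)
  ^ⁿ-^ⁿ x m zero    = ^ⁿ-≡ x (≡.sym (ℕP.*-zeroʳ m))
  ^ⁿ-^ⁿ x m (suc n) = begin
    x ^ⁿ m * (x ^ⁿ m) ^ⁿ n  ≈⟨ *-cong refl (^ⁿ-^ⁿ x m n) ⟩
    x ^ⁿ m * x ^ⁿ (m ℕ.* n) ≈⟨ ^ⁿ-+ x m (m ℕ.* n) ⟨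
    x ^ⁿ (m ℕ.+ m ℕ.* n)    ≈⟨ ^ⁿ-≡ x (≡.sym (ℕP.*-suc m n)) ⟩
    x ^ⁿ (m ℕ.* suc n)      ∎

  ⁻¹-inverseˡ : ∀ x → NonZero K x → x ⁻¹ * x ≈ 1#
  ⁻¹-inverseˡ x x≉0 = trans (*-comm _ _) (inverseʳ x x≉0)

  ⁻¹-unique : ∀ x u → NonZero K x → x * u ≈ 1# → x ⁻¹ ≈ u
  ⁻¹-unique x u x≉0 xu≈1 = begin
    x ⁻¹             ≈⟨ *-identityʳ _ ⟨
    x ⁻¹ * 1#        ≈⟨ *-cong refl xu≈1 ⟨
    x ⁻¹ * (x * u)   ≈⟨ *-assoc _ _ _ ⟨
    (x ⁻¹ * x) * u   ≈⟨ *-cong (⁻¹-inverseˡ x x≉0) refl ⟩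
    1# * u           ≈⟨ *-identityˡ u ⟩
    u                ∎

  *-cancelˡ : ∀ x u v → NonZero K x → x * u ≈ x * v → u ≈ v
  *-cancelˡ x u v x≉0 xu≈xv = begin
    u                ≈⟨ *-identityˡ u ⟨
    1# * u           ≈⟨ *-cong (⁻¹-inverseˡ x x≉0) refl ⟨
    (x ⁻¹ * x) * u   ≈⟨ *-assoc _ _ _ ⟩
    x ⁻¹ * (x * u)   ≈⟨ *-cong refl xu≈xv ⟩
    x ⁻¹ * (x * v)   ≈⟨ *-assoc _ _ _ ⟨
    (x ⁻¹ * x) * v   ≈⟨ *-cong (⁻¹-inverseˡ x x≉0) refl ⟩
    1# * v           ≈⟨ *-identityˡ v ⟩
    v                ∎

  nonzero-* : ∀ x y → NonZero K x → NonZero K y → NonZero K (x * y)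
  nonzero-* x y x≉0 y≉0 xy≈0 =
    y≉0 (*-cancelˡ x y 0# x≉0 (trans xy≈0 (sym (zeroʳ x))))

  nonzero-^ⁿ : ∀ x n → NonZero K x → NonZero K (x ^ⁿ n)
  nonzero-^ⁿ x zero    x≉0 = 1≉0
  nonzero-^ⁿ x (suc n) x≉0 = nonzero-* x _ x≉0 (nonzero-^ⁿ x n x≉0)

  nonzero-⁻¹ : ∀ x → NonZero K x → NonZero K (x ⁻¹)
  nonzero-⁻¹ x x≉0 x⁻¹≈0 =
    1≉0 (trans (sym (inverseʳ x x≉0)) (trans (*-cong refl x⁻¹≈0) (zeroʳ x)))

  ⁻¹-cong : ∀ x y → NonZero K x → x ≈ y → x ⁻¹ ≈ y ⁻¹
  ⁻¹-cong x y x≉0 x≈y = ⁻¹-unique x (y ⁻¹) x≉0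
    (trans (*-cong x≈y refl) (inverseʳ y (λ y≈0 → x≉0 (trans x≈y y≈0))))

  ⁻¹-* : ∀ x y → NonZero K x → NonZero K y → (x * y) ⁻¹ ≈ x ⁻¹ * y ⁻¹
  ⁻¹-* x y x≉0 y≉0 = ⁻¹-unique (x * y) _ (nonzero-* x y x≉0 y≉0) (begin
    (x * y) * (x ⁻¹ * y ⁻¹)   ≈⟨ interchange x y _ _ ⟩
    (x * x ⁻¹) * (y * y ⁻¹)   ≈⟨ *-cong (inverseʳ x x≉0) (inverseʳ y y≉0) ⟩
    1# * 1#                   ≈⟨ *-identityʳ 1# ⟩
    1#                        ∎)

  ^ⁿ-⁻¹ : ∀ x n → NonZero K x → x ^ⁿ n * x ⁻¹ ^ⁿ n ≈ 1#
  ^ⁿ-⁻¹ x n x≉0 =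
    trans (sym (*-^ⁿ x (x ⁻¹) n)) (trans (^ⁿ-cong n (inverseʳ x x≉0)) (1-^ⁿ n))

  -- Integer powers of a nonzero x.  Writing an exponent as a difference
  -- a ⊖ b of naturals reduces their laws to those of natural powers.

  ^ᶻ-⊖ : ∀ x → NonZero K x → ∀ a b → x ^ᶻ (a ⊖ b) ≈ x ^ⁿ a * x ⁻¹ ^ⁿ b
  ^ᶻ-⊖ x x≉0 a       zero    = sym (*-identityʳ _)
  ^ᶻ-⊖ x x≉0 zero    (suc b) = sym (*-identityˡ _)
  ^ᶻ-⊖ x x≉0 (suc a) (suc b) = begin
    x ^ᶻ (suc a ⊖ suc b)               ≈⟨ reflexive (≡.cong (x ^ᶻ_) (ℤP.[1+m]⊖[1+n]≡m⊖n a b)) ⟩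
    x ^ᶻ (a ⊖ b)                       ≈⟨ ^ᶻ-⊖ x x≉0 a b ⟩
    x ^ⁿ a * x ⁻¹ ^ⁿ b                 ≈⟨ *-identityˡ _ ⟨
    1# * (x ^ⁿ a * x ⁻¹ ^ⁿ b)          ≈⟨ *-cong (inverseʳ x x≉0) refl ⟨
    (x * x ⁻¹) * (x ^ⁿ a * x ⁻¹ ^ⁿ b)  ≈⟨ interchange x _ _ _ ⟩
    x ^ⁿ suc a * x ⁻¹ ^ⁿ suc b         ∎

  ^ᶻ-⊖-+ : ∀ x → NonZero K x → ∀ a b j →
           x ^ᶻ ((a ⊖ b) ℤ.+ j) ≈ x ^ᶻ (a ⊖ b) * x ^ᶻ j
  ^ᶻ-⊖-+ x x≉0 a b (+ n) = begin
    x ^ᶻ ((a ⊖ b) ℤ.+ + n)            ≈⟨ reflexive (≡.cong (x ^ᶻ_) (ℤP.distribˡ-⊖-+-pos n a b)) ⟩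
    x ^ᶻ ((a ℕ.+ n) ⊖ b)              ≈⟨ ^ᶻ-⊖ x x≉0 (a ℕ.+ n) b ⟩
    x ^ⁿ (a ℕ.+ n) * x ⁻¹ ^ⁿ b        ≈⟨ *-cong (^ⁿ-+ x a n) refl ⟩
    (x ^ⁿ a * x ^ⁿ n) * x ⁻¹ ^ⁿ b     ≈⟨ xy∙z≈xz∙y _ _ _ ⟩
    (x ^ⁿ a * x ⁻¹ ^ⁿ b) * x ^ⁿ n     ≈⟨ *-cong (^ᶻ-⊖ x x≉0 a b) refl ⟨
    x ^ᶻ (a ⊖ b) * x ^ᶻ + n           ∎
  ^ᶻ-⊖-+ x x≉0 a b -[1+ n ] = begin
    x ^ᶻ ((a ⊖ b) ℤ.+ -[1+ n ])           ≈⟨ reflexive (≡.cong (x ^ᶻ_) (ℤP.distribˡ-⊖-+-neg n a b)) ⟩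
    x ^ᶻ (a ⊖ suc (b ℕ.+ n))              ≈⟨ ^ᶻ-⊖ x x≉0 a (suc (b ℕ.+ n)) ⟩
    x ^ⁿ a * x ⁻¹ ^ⁿ suc (b ℕ.+ n)        ≈⟨ *-cong refl (^ⁿ-≡ (x ⁻¹) (≡.sym (ℕP.+-suc b n))) ⟩
    x ^ⁿ a * x ⁻¹ ^ⁿ (b ℕ.+ suc n)        ≈⟨ *-cong refl (^ⁿ-+ (x ⁻¹) b (suc n)) ⟩
    x ^ⁿ a * (x ⁻¹ ^ⁿ b * x ⁻¹ ^ⁿ suc n)  ≈⟨ *-assoc _ _ _ ⟨
    (x ^ⁿ a * x ⁻¹ ^ⁿ b) * x ⁻¹ ^ⁿ suc n  ≈⟨ *-cong (^ᶻ-⊖ x x≉0 a b) refl ⟨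
    x ^ᶻ (a ⊖ b) * x ^ᶻ -[1+ n ]          ∎

  -- Every integer is n ⊖ 0 or 0 ⊖ (n + 1), definitionally.
  ^ᶻ-+ : ∀ x → NonZero K x → ∀ i j → x ^ᶻ (i ℤ.+ j) ≈ x ^ᶻ i * x ^ᶻ j
  ^ᶻ-+ x x≉0 (+ n)     = ^ᶻ-⊖-+ x x≉0 n 0
  ^ᶻ-+ x x≉0 -[1+ n ]  = ^ᶻ-⊖-+ x x≉0 0 (suc n)

  *-^ᶻ : ∀ x y → NonZero K x → NonZero K y → ∀ i → (x * y) ^ᶻ i ≈ x ^ᶻ i * y ^ᶻ i
  *-^ᶻ x y x≉0 y≉0 (+ n)    = *-^ⁿ x y n
  *-^ᶻ x y x≉0 y≉0 -[1+ n ] =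
    trans (^ⁿ-cong (suc n) (⁻¹-* x y x≉0 y≉0)) (*-^ⁿ (x ⁻¹) (y ⁻¹) (suc n))

  ^ᶻ-cong : ∀ x y → NonZero K x → x ≈ y → ∀ i → x ^ᶻ i ≈ y ^ᶻ i
  ^ᶻ-cong x y x≉0 x≈y (+ n)    = ^ⁿ-cong n x≈y
  ^ᶻ-cong x y x≉0 x≈y -[1+ n ] = ^ⁿ-cong (suc n) (⁻¹-cong x y x≉0 x≈y)

  nonzero-^ᶻ : ∀ x → NonZero K x → ∀ i → NonZero K (x ^ᶻ i)
  nonzero-^ᶻ x x≉0 (+ n)    = nonzero-^ⁿ x n x≉0
  nonzero-^ᶻ x x≉0 -[1+ n ] = nonzero-^ⁿ (x ⁻¹) (suc n) (nonzero-⁻¹ x x≉0)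

  InSub-resp : ∀ q m {x y} → x ≈ y → InSub K q m x → InSub K q m y
  InSub-resp q m x≈y x∈ = trans (^ⁿ-cong (q ^ m) (sym x≈y)) (trans x∈ x≈y)

  InSub-^ⁿ : ∀ q m x n → InSub K q m x → InSub K q m (x ^ⁿ n)
  InSub-^ⁿ q m x n x∈ = begin
    (x ^ⁿ n) ^ⁿ (q ^ m)  ≈⟨ ^ⁿ-^ⁿ x n (q ^ m) ⟩
    x ^ⁿ (n ℕ.* q ^ m)   ≈⟨ ^ⁿ-≡ x (ℕP.*-comm n (q ^ m)) ⟩
    x ^ⁿ (q ^ m ℕ.* n)   ≈⟨ ^ⁿ-^ⁿ x (q ^ m) n ⟨
    (x ^ⁿ (q ^ m)) ^ⁿ n  ≈⟨ ^ⁿ-cong n x∈ ⟩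
    x ^ⁿ n               ∎

  InSub-⁻¹ : ∀ q m y → NonZero K y → InSub K q m y → InSub K q m (y ⁻¹)
  InSub-⁻¹ q m y y≉0 y∈ = sym (⁻¹-unique y _ y≉0
    (trans (*-cong (sym y∈) refl) (^ⁿ-⁻¹ y (q ^ m) y≉0)))

  -- y^{θ_s} is the norm of y from F_{q^{s+1}} to F_q: raising it to the
  -- q-th power multiplies by y^{q^{s+1}} / y = 1.
  norm∈Fq : ∀ q s y → NonZero K y → InSub K q (suc s) y → InFq K q (y ^ⁿ θ q s)
  norm∈Fq q s y y≉0 y∈ = *-cancelˡ y _ _ y≉0 (begin
    y * (y ^ⁿ θ q s) ^ⁿ (q ^ 1)       ≈⟨ *-cong refl (^ⁿ-^ⁿ y (θ q s) (q ^ 1)) ⟩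
    y ^ⁿ suc (θ q s ℕ.* (q ^ 1))      ≈⟨ ^ⁿ-≡ y exponent ⟩
    y ^ⁿ (θ q s ℕ.+ q ^ suc s)        ≈⟨ ^ⁿ-+ y (θ q s) (q ^ suc s) ⟩
    y ^ⁿ θ q s * y ^ⁿ (q ^ suc s)     ≈⟨ *-cong refl y∈ ⟩
    y ^ⁿ θ q s * y                    ≈⟨ *-comm _ _ ⟩
    y * y ^ⁿ θ q s                    ∎)
    where
    exponent : suc (θ q s ℕ.* (q ^ 1)) ≡ θ q s ℕ.+ q ^ suc s
    exponent = ≡.trans (≡.cong (λ r → suc (θ q s ℕ.* r)) (ℕP.*-identityʳ q)) (θ-shift q s)


  norm-power∈Fq : ∀ q s y → NonZero K y → InSub K q (suc s) y →
                  ∀ k → InFq K q (y ^ⁿ (k ℕ.* θ q s))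
  norm-power∈Fq q s y y≉0 y∈ k = InSub-resp q 1
    (trans (^ⁿ-^ⁿ y (θ q s) k) (^ⁿ-≡ y (ℕP.*-comm (θ q s) k)))
    (InSub-^ⁿ q 1 _ k (norm∈Fq q s y y≉0 y∈))

  ^ᶻ-θ-multiple∈Fq : ∀ q s y → NonZero K y → InSub K q (suc s) y →
                     ∀ i → + θ q s ∣ i → InFq K q (y ^ᶻ i)
  ^ᶻ-θ-multiple∈Fq q s y y≉0 y∈ (+ n) (divides k n≡kθ) =
    ≡.subst (λ e → InFq K q (y ^ⁿ e)) (≡.sym n≡kθ) (norm-power∈Fq q s y y≉0 y∈ k)
  ^ᶻ-θ-multiple∈Fq q s y y≉0 y∈ -[1+ n ] (divides k 1+n≡kθ) =
    ≡.subst (λ e → InFq K q (y ⁻¹ ^ⁿ e)) (≡.sym 1+n≡kθ)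
      (norm-power∈Fq q s (y ⁻¹) (nonzero-⁻¹ y y≉0) (InSub-⁻¹ q (suc s) y y≉0 y∈) k)

  scaling-IsGL : ∀ q γ → NonZero K γ → IsGL K q (γ *_)
  scaling-IsGL q γ γ≉0 =
      (λ x y x≈y → *-cong refl x≈y)
    , (λ x y → distribˡ γ x y)
    , (λ λ₁ x _ → x∙yz≈y∙xz γ λ₁ x)
    , (λ x y → *-cancelˡ γ x y γ≉0)
    , (λ y → γ ⁻¹ * y , trans (sym (*-assoc _ _ _))
                          (trans (*-cong (inverseʳ γ γ≉0) refl) (*-identityˡ y)))

  pointwise⇒PGLEquiv : ∀ q a b d d′ φ → IsGL K q φ →
    (∀ x → InLine K q a b x → NonZero K x → SamePoint K q (φ (x ^ᶻ d)) (x ^ᶻ d′)) →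
    PGLEquivPowers K q a b d d′
  pointwise⇒PGLEquiv q a b d d′ φ φ∈GL maps =
    φ , φ∈GL , (λ x x∈ℓ x≉0 → x , x∈ℓ , x≉0 , maps x x∈ℓ x≉0)
             , (λ x x∈ℓ x≉0 → x , x∈ℓ , x≉0 , maps x x∈ℓ x≉0)

  -- The core argument: if ℓ̂ ⊆ γ·F_{q^{s+1}} and θ_s ∣ d - d′, the scaling
  -- by κ = γ^{d′-d} maps ⟨x^d⟩ to ⟨x^{d′}⟩, since for x = γ·y both
  -- γ^{d′-d}·x^d and y^{d-d′}·x^{d′} equal γ^{d′}·y^d.
  powers-of-scaled-subfield : ∀ q s a b γ d d′ → NonZero K γ →
    (∀ x → InLine K q a b x → ∃[ y ] (InSub K q (suc s) y × (x ≈ (γ * y)))) →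
    + θ q s ∣ (d - d′) → PGLEquivPowers K q a b d d′
  powers-of-scaled-subfield q s a b γ d d′ γ≉0 ℓ̂⊆γF θ∣d-d′ =
    pointwise⇒PGLEquiv q a b d d′ (κ *_) (scaling-IsGL q κ κ≉0) maps
    where
    κ : Carrier
    κ = γ ^ᶻ (d′ - d)

    κ≉0 : NonZero K κ
    κ≉0 = nonzero-^ᶻ γ γ≉0 (d′ - d)

    maps : ∀ x → InLine K q a b x → NonZero K x → SamePoint K q (κ * x ^ᶻ d) (x ^ᶻ d′)
    maps x x∈ℓ x≉0 with ℓ̂⊆γF x x∈ℓ
    ... | y , y∈ , x≈γy =
        y ^ᶻ (d - d′)
      , ^ᶻ-θ-multiple∈Fq q s y y≉0 y∈ (d - d′) θ∣d-d′
      , nonzero-^ᶻ y y≉0 (d - d′)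
      , (begin
          κ * x ^ᶻ d                          ≈⟨ *-cong refl (power-of-x d) ⟩
          κ * (γ ^ᶻ d * y ^ᶻ d)               ≈⟨ *-assoc _ _ _ ⟨
          (κ * γ ^ᶻ d) * y ^ᶻ d               ≈⟨ *-cong (sum-of-exponents γ γ≉0 d′ d) refl ⟩
          γ ^ᶻ d′ * y ^ᶻ d                    ≈⟨ *-cong refl (sum-of-exponents y y≉0 d d′) ⟨
          γ ^ᶻ d′ * (y ^ᶻ (d - d′) * y ^ᶻ d′) ≈⟨ x∙yz≈y∙xz _ _ _ ⟩
          y ^ᶻ (d - d′) * (γ ^ᶻ d′ * y ^ᶻ d′) ≈⟨ *-cong refl (power-of-x d′) ⟨
          y ^ᶻ (d - d′) * x ^ᶻ d′             ∎)
      where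
      y≉0 : NonZero K y
      y≉0 y≈0 = x≉0 (trans x≈γy (trans (*-cong refl y≈0) (zeroʳ γ)))

      power-of-x : ∀ i → x ^ᶻ i ≈ γ ^ᶻ i * y ^ᶻ i
      power-of-x i = trans (^ᶻ-cong x _ x≉0 x≈γy i) (*-^ᶻ γ y γ≉0 y≉0 i)

      sum-of-exponents : ∀ z → NonZero K z → ∀ i j → z ^ᶻ (i - j) * z ^ᶻ j ≈ z ^ᶻ i
      sum-of-exponents z z≉0 i j =
        trans (sym (^ᶻ-+ z z≉0 (i - j) j)) (reflexive (≡.cong (z ^ᶻ_) (minus-plus i j)))

-- Proposition 5.3.  o(ℓ) = m = s + 1 provides γ ≠ 0 with ℓ̂ ⊆ γ·F_{q^m}.
proposition5p3 : ∀ {c ℓ : Level} (K : Field c ℓ) (p k q t : ℕ) → Prime p → 1 ≤ k → q ≡ p ^ k →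
    HasCard K (q ^ t) →
    (a b : Field.Carrier K) → IsLine K q a b →
    (m : ℕ) → HasOrder K q t a b m →
    (d d′ : ℤ) → (+ θ q (m ∸ 1)) ∣ (d - d′) →
    PGLEquivPowers K q a b d d′
proposition5p3 K p k q t _ _ _ _ a b _ (suc s) (_ , (_ , γ , γ≉0 , ℓ̂⊆γF) , _) d d′ θ∣d-d′ =
  FieldTheory.powers-of-scaled-subfield K q s a b γ d d′ γ≉0 ℓ̂⊆γF θ∣d-d′
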